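{- Let $n \geq 6$ and let $K_{n,n}$ have bipartition $(X,Y)$. Let $T = T_1\cup T_2$ be a strong geodetic set of $K_{n,n}$ with $T_1\subseteq X$, $T_2\subseteq Y$, and let $t_i = |T_i|$ for $i\in\{1,2\}$. If $|t_1-t_2|\geq 2$, then there exists a strong geodetic set $T' = T_1'\cup T_2'$ with $T_1'\subseteq X$, $T_2'\subseteq Y$, such that $|T'| = |T|$ and $|t_1'-t_2'| < |t_1-t_2|$, where $t_i' = |T_i'|$ for $i \in \{1,2\}$.
   Context: All graphs are finite, simple and connected. For a graph $G=(V,E)$ and a set $S\subseteq V$, for each pair of distinct vertices $\{x,y\}\subseteq S$ one selects one fixed shortest $x,y$-path $\widetilde g(x,y)$. The set $S$ is a strong geodetic set if for some such choice of fixed shortest paths, every vertex of $G$ lies on at least one of the selected paths. $K_{n,n}$ is the complete bipartite graph with both parts of size $n$. -}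

module Defs where

open import Data.Nat using (ℕ; _≤_)
open import Data.Bool using (Bool; true; false)
open import Data.List using (List; []; _∷_; length; reverse)
open import Data.List.Membership.Propositional using (_∈_)
open import Data.Fin using (Fin)
open import Data.Fin.Subset using (Subset)
open import Data.Vec using (lookup)
open import Data.Sum using (_⊎_; inj₁; inj₂)
open import Data.Product using (_×_; ∃-syntax; Σ-syntax)
open import Data.Unit using (⊤)
open import Data.Empty using (⊥)
open import Relation.Binary.PropositionalEquality using (_≡_; _≢_)

module _ {V : Set} (Adj : V → V → Set) where

  WalkFrom : V → V → List V → Set
  WalkFrom v y []       = v ≡ y
  WalkFrom v y (w ∷ ws) = Adj v w × WalkFrom w y ws

  IsWalk : V → V → List V → Set
  IsWalk x y []       = ⊥
  IsWalk x y (v ∷ vs) = x ≡ v × WalkFrom v y vs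

  -- a shortest x,y-path: a walk from x to y with the minimum number of vertices
  -- (a minimum walk is automatically a path)
  IsShortestPath : V → V → List V → Set
  IsShortestPath x y p = IsWalk x y p × (∀ q → IsWalk x y q → length p ≤ length q)

  -- S is strong geodetic if there is a choice g of a fixed shortest path for
  -- each unordered pair {x,y} of distinct vertices of S (encoded as
  -- g x y, with g y x the same path reversed), such that every vertex of the
  -- graph lies on one of the selected paths.
  StrongGeodetic : (V → Bool) → Set
  StrongGeodetic S =
    Σ[ g ∈ (V → V → List V) ] ( (∀ x y → S x ≡ true → S y ≡ true → x ≢ y →
                 IsShortestPath x y (g x y) × g y x ≡ reverse (g x y))
           × (∀ v → ∃[ x ] ∃[ y ] (S x ≡ true × S y ≡ true × x ≢ y × v ∈ g x y)) )

-- K_{n,n}: vertices Fin n ⊎ Fin n, X = inj₁ part, Y = inj₂ part.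
KV : ℕ → Set
KV n = Fin n ⊎ Fin n

KAdj : (n : ℕ) → KV n → KV n → Set
KAdj n (inj₁ _) (inj₁ _) = ⊥
KAdj n (inj₁ _) (inj₂ _) = ⊤
KAdj n (inj₂ _) (inj₁ _) = ⊤
KAdj n (inj₂ _) (inj₂ _) = ⊥

KSet : {n : ℕ} → Subset n → Subset n → KV n → Bool
KSet T₁ T₂ (inj₁ i) = lookup T₁ i
KSet T₁ T₂ (inj₂ j) = lookup T₂ j

-- In K_{n,n} every shortest path has at most three vertices, so a vertex of X
-- outside T₁ can only be covered as the middle vertex of the geodesic between
-- two vertices of T₂; hence n − t₁ ≤ C(t₂,2). Conversely, the first a vertices
-- of X together with the first b vertices of Y form a strong geodetic set as
-- soon as a, b ≥ 1, n ≤ a + C(b,2) and n ≤ b + C(a,2): route the geodesic of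
-- the k-th pair of chosen Y-vertices through the (a+k)-th vertex of X, and vice
-- versa. If t₁ ≥ t₂ + 2, the balanced sizes a = ⌈(t₁+t₂)/2⌉ ≥ b = ⌊(t₁+t₂)/2⌋
-- satisfy these conditions because C(t₂+d,2) ≥ C(t₂,2) + d for t₂ ≥ 1 (for
-- t₂ = 0 one uses n ≥ 6 instead). The case t₂ > t₁ follows by exchanging X and Y.

module Submission where

open import Defs
open import Data.Nat using (ℕ; zero; suc; _≤_; _<_; _+_; _∸_; ∣_-_∣; _⊔_; _⊓_; z≤n; s≤s; _<?_; NonZero; >-nonZero; ⌊_/2⌋; ⌈_/2⌉)
open import Data.Nat.Properties
open import Data.Nat.Combinatorics using (_C_; nC1≡n; nCk+nC[k+1]≡[n+1]C[k+1])
open import Data.Nat.DivMod using (_mod_; m<n⇒m%n≡m)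
open import Data.Bool using (Bool; true)
open import Data.Fin using (Fin; zero; suc; toℕ; fromℕ<)
open import Data.Fin.Properties using (toℕ-fromℕ<; toℕ-injective; toℕ<n)
open import Data.Fin.Subset using (Subset; ∣_∣; ∁; ⁅_⁆; _∪_; ⋃; ⊥; inside; outside)
  renaming (_∈_ to _∈ˢ_; _∉_ to _∉ˢ_)
open import Data.Fin.Subset.Properties using (∣∁p∣≡n∸∣p∣; ∣p∣≤n; p⊆q⇒∣p∣≤∣q∣; ∣⊥∣≡0; ∣⁅x⁆∣≡1; ∣p∣≤∣x∷p∣; x∈⁅x⁆; x∈p∪q⁺; x∈∁p⇒x∉p)
open import Data.Vec using (lookup; []; _∷_)
open import Data.Vec.Properties using (lookup⇒[]=)
open import Data.List using (List; []; _∷_; length; map; reverse; _++_)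
open import Data.List.Properties using (length-map; length-++; reverse-map)
open import Data.List.Membership.Propositional using (_∈_)
open import Data.List.Membership.Propositional.Properties using (∈-map⁺; ∈-++⁺ˡ; ∈-++⁺ʳ)
open import Data.List.Relation.Unary.Any using (here; there)
open import Data.Sum using (_⊎_; inj₁; inj₂; swap)
open import Data.Sum.Properties using (swap-involutive; inj₂-injective)
open import Data.Product using (_×_; _,_; ∃-syntax; ∃₂; proj₁)
open import Data.Unit using (tt)
open import Data.Empty using (⊥-elim)
open import Relation.Nullary using (¬_; yes; no)
open import Function using (_∘_)
open import Relation.Binary.PropositionalEquality

module _ {V : Set} {Adj : V → V → Set} where

  walk-length≥2 : ∀ {x y} p → x ≢ y → IsWalk Adj x y p → 2 ≤ length p
  walk-length≥2 []          _   ()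
  walk-length≥2 (_ ∷ [])    x≢y (refl , refl) = ⊥-elim (x≢y refl)
  walk-length≥2 (_ ∷ _ ∷ _) _   _             = s≤s (s≤s z≤n)

  walk-length≥3 : ∀ {x y} p → x ≢ y → ¬ Adj x y → IsWalk Adj x y p → 3 ≤ length p
  walk-length≥3 []              _   _   ()
  walk-length≥3 (_ ∷ [])        x≢y _   (refl , refl)       = ⊥-elim (x≢y refl)
  walk-length≥3 (_ ∷ _ ∷ [])    _   x≁y (refl , x~y , refl) = ⊥-elim (x≁y x~y)
  walk-length≥3 (_ ∷ _ ∷ _ ∷ _) _   _   _                   = s≤s (s≤s (s≤s z≤n))

  short-walk : ∀ {x y} p → x ≢ y → IsWalk Adj x y p → length p ≤ 3 →
               p ≡ x ∷ y ∷ [] ⊎ ∃[ w ] (p ≡ x ∷ w ∷ y ∷ [] × Adj x w × Adj w y)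
  short-walk []                  _   ()
  short-walk (_ ∷ [])            x≢y (refl , refl)              _ = ⊥-elim (x≢y refl)
  short-walk (_ ∷ _ ∷ [])        _   (refl , _ , refl)          _ = inj₁ refl
  short-walk (_ ∷ w ∷ _ ∷ [])    _   (refl , x~w , w~y , refl) _ = inj₂ (w , refl , x~w , w~y)
  short-walk (_ ∷ _ ∷ _ ∷ _ ∷ _) _   _ (s≤s (s≤s (s≤s ())))

involutive⇒injective : ∀ {A : Set} (f : A → A) → (∀ x → f (f x) ≡ x) → ∀ {x y} → f x ≡ f y → x ≡ y
involutive⇒injective f f-involutive {x} {y} fx≡fy =
  trans (sym (f-involutive x)) (trans (cong f fx≡fy) (f-involutive y))

Covers : ∀ {V : Set} → (V → Bool) → (V → V → List V) → V → Set
Covers S g v = ∃[ x ] ∃[ y ] (S x ≡ true × S y ≡ true × x ≢ y × v ∈ g x y)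

module _ {V : Set} {Adj : V → V → Set} (f : V → V)
         (f-involutive : ∀ x → f (f x) ≡ x)
         (f-adj : ∀ {x y} → Adj x y → Adj (f x) (f y)) where

  private
    f-injective : ∀ {x y} → f x ≡ f y → x ≡ y
    f-injective = involutive⇒injective f f-involutive

  walkFrom-map : ∀ {v y} p → WalkFrom Adj v y p → WalkFrom Adj (f v) (f y) (map f p)
  walkFrom-map []      refl           = refl
  walkFrom-map (_ ∷ p) (v~w , p-walk) = f-adj v~w , walkFrom-map p p-walk

  isWalk-map : ∀ {x y} p → IsWalk Adj x y p → IsWalk Adj (f x) (f y) (map f p)
  isWalk-map (_ ∷ p) (refl , p-walk) = refl , walkFrom-map p p-walk

  isShortestPath-map : ∀ {x y} p → IsShortestPath Adj x y p → IsShortestPath Adj (f x) (f y) (map f p)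
  isShortestPath-map {x} {y} p (p-walk , p-min) = isWalk-map p p-walk , λ q q-walk → begin
    length (map f p) ≡⟨ length-map f p ⟩
    length p         ≤⟨ p-min (map f q) (subst₂ (λ x′ y′ → IsWalk Adj x′ y′ (map f q))
                                           (f-involutive x) (f-involutive y) (isWalk-map q q-walk)) ⟩
    length (map f q) ≡⟨ length-map f q ⟩
    length q         ∎
    where open ≤-Reasoning

  strongGeodetic-involution : ∀ (S S′ : V → Bool) → (∀ x → S′ x ≡ S (f x)) →
                              StrongGeodetic Adj S → StrongGeodetic Adj S′
  strongGeodetic-involution S S′ S′≡S∘f (g , g-geodesic , g-covers) = g′ , g′-geodesic , g′-covers
    where
    g′ : V → V → List V
    g′ x y = map f (g (f x) (f y))

    S′⇒S∘f : ∀ {x} → S′ x ≡ true → S (f x) ≡ true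
    S′⇒S∘f {x} = trans (sym (S′≡S∘f x))

    S⇒S′∘f : ∀ {x} → S x ≡ true → S′ (f x) ≡ true
    S⇒S′∘f {x} = trans (trans (S′≡S∘f (f x)) (cong S (f-involutive x)))

    g′-geodesic : ∀ x y → S′ x ≡ true → S′ y ≡ true → x ≢ y →
                  IsShortestPath Adj x y (g′ x y) × g′ y x ≡ reverse (g′ x y)
    g′-geodesic x y x∈S′ y∈S′ x≢y
      with g-geodesic (f x) (f y) (S′⇒S∘f x∈S′) (S′⇒S∘f y∈S′) (x≢y ∘ f-injective)
    ... | sp , rev =
      subst₂ (λ x′ y′ → IsShortestPath Adj x′ y′ (g′ x y)) (f-involutive x) (f-involutive y)
        (isShortestPath-map _ sp) ,
      trans (cong (map f) rev) (reverse-map f (g (f x) (f y)))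

    g′-covers : ∀ v → Covers S′ g′ v
    g′-covers v with g-covers (f v)
    ... | x , y , x∈S , y∈S , x≢y , fv∈gxy =
      f x , f y , S⇒S′∘f x∈S , S⇒S′∘f y∈S , x≢y ∘ f-injective ,
      subst₂ (λ x′ y′ → v ∈ map f (g x′ y′)) (sym (f-involutive x)) (sym (f-involutive y))
        (subst (_∈ map f (g x y)) (f-involutive v) (∈-map⁺ f fv∈gxy))

elements : ∀ {n} → Subset n → List (Fin n)
elements []            = []
elements (inside ∷ p)  = zero ∷ map suc (elements p)
elements (outside ∷ p) = map suc (elements p)

length-elements : ∀ {n} (p : Subset n) → length (elements p) ≡ ∣ p ∣
length-elements []            = refl
length-elements (inside ∷ p)  = cong suc (trans (length-map suc (elements p)) (length-elements p))
length-elements (outside ∷ p) = trans (length-map suc (elements p)) (length-elements p)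

elements-complete : ∀ {n} (p : Subset n) {i} → lookup p i ≡ true → i ∈ elements p
elements-complete (inside ∷ p)  {zero}  _    = here refl
elements-complete (inside ∷ p)  {suc i} i∈p = there (∈-map⁺ suc (elements-complete p i∈p))
elements-complete (outside ∷ p) {suc i} i∈p = ∈-map⁺ suc (elements-complete p i∈p)

fromList : ∀ {n} → List (Fin n) → Subset n
fromList = ⋃ ∘ map ⁅_⁆

∣p∪q∣≤∣p∣+∣q∣ : ∀ {n} (p q : Subset n) → ∣ p ∪ q ∣ ≤ ∣ p ∣ + ∣ q ∣
∣p∪q∣≤∣p∣+∣q∣ []            []            = z≤n
∣p∪q∣≤∣p∣+∣q∣ (inside ∷ p)  (t ∷ q)       =
  s≤s (≤-trans (∣p∪q∣≤∣p∣+∣q∣ p q) (+-monoʳ-≤ ∣ p ∣ (∣p∣≤∣x∷p∣ t q)))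
∣p∪q∣≤∣p∣+∣q∣ (outside ∷ p) (inside ∷ q)  =
  ≤-trans (s≤s (∣p∪q∣≤∣p∣+∣q∣ p q)) (≤-reflexive (sym (+-suc ∣ p ∣ ∣ q ∣)))
∣p∪q∣≤∣p∣+∣q∣ (outside ∷ p) (outside ∷ q) = ∣p∪q∣≤∣p∣+∣q∣ p q

∣fromList∣≤length : ∀ {n} (xs : List (Fin n)) → ∣ fromList xs ∣ ≤ length xs
∣fromList∣≤length {n} []       = ≤-reflexive (∣⊥∣≡0 n)
∣fromList∣≤length      (x ∷ xs) = begin
  ∣ ⁅ x ⁆ ∪ fromList xs ∣       ≤⟨ ∣p∪q∣≤∣p∣+∣q∣ ⁅ x ⁆ (fromList xs) ⟩
  ∣ ⁅ x ⁆ ∣ + ∣ fromList xs ∣   ≤⟨ +-mono-≤ (≤-reflexive (∣⁅x⁆∣≡1 x)) (∣fromList∣≤length xs) ⟩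
  suc (length xs)               ∎
  where open ≤-Reasoning

∈⇒∈fromList : ∀ {n} {x : Fin n} {xs} → x ∈ xs → x ∈ˢ fromList xs
∈⇒∈fromList {x = x} (here refl) = x∈p∪q⁺ (inj₁ (x∈⁅x⁆ x))
∈⇒∈fromList         (there x∈xs) = x∈p∪q⁺ (inj₂ (∈⇒∈fromList x∈xs))

∣∁p∣≤length : ∀ {n} (p : Subset n) (xs : List (Fin n)) → (∀ {i} → i ∉ˢ p → i ∈ xs) → ∣ ∁ p ∣ ≤ length xs
∣∁p∣≤length p xs ∁p⊆xs =
  ≤-trans (p⊆q⇒∣p∣≤∣q∣ (λ i∈∁p → ∈⇒∈fromList (∁p⊆xs (x∈∁p⇒x∉p i∈∁p)))) (∣fromList∣≤length xs)

[1+n]C2≡n+nC2 : ∀ n → suc n C 2 ≡ n + n C 2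
[1+n]C2≡n+nC2 n = trans (sym (nCk+nC[k+1]≡[n+1]C[k+1] n 1)) (cong (_+ n C 2) (nC1≡n n))

pairs : ∀ {A : Set} → List A → List (A × A)
pairs []       = []
pairs (x ∷ xs) = map (x ,_) xs ++ pairs xs

length-pairs : ∀ {A : Set} (xs : List A) → length (pairs xs) ≡ length xs C 2
length-pairs []       = refl
length-pairs (x ∷ xs) = begin
  length (map (x ,_) xs ++ pairs xs)           ≡⟨ length-++ (map (x ,_) xs) ⟩
  length (map (x ,_) xs) + length (pairs xs)   ≡⟨ cong₂ _+_ (length-map (x ,_) xs) (length-pairs xs) ⟩
  length xs + length xs C 2                    ≡⟨ [1+n]C2≡n+nC2 (length xs) ⟨
  suc (length xs) C 2                          ∎
  where open ≡-Reasoning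

pairs-complete : ∀ {A : Set} {x y : A} {xs} → x ∈ xs → y ∈ xs → x ≢ y →
                 (x , y) ∈ pairs xs ⊎ (y , x) ∈ pairs xs
pairs-complete              (here refl)  (here refl)  x≢y = ⊥-elim (x≢y refl)
pairs-complete {xs = z ∷ zs} (here refl)  (there y∈zs) _ = inj₁ (∈-++⁺ˡ (∈-map⁺ (z ,_) y∈zs))
pairs-complete {xs = z ∷ zs} (there x∈zs) (here refl)  _ = inj₂ (∈-++⁺ˡ (∈-map⁺ (z ,_) x∈zs))
pairs-complete {xs = z ∷ zs} (there x∈zs) (there y∈zs) x≢y with pairs-complete x∈zs y∈zs x≢y
... | inj₁ xy∈ = inj₁ (∈-++⁺ʳ (map (z ,_) zs) xy∈)
... | inj₂ yx∈ = inj₂ (∈-++⁺ʳ (map (z ,_) zs) yx∈)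

swap-adj : ∀ {n} {x y : KV n} → KAdj n x y → KAdj n (swap x) (swap y)
swap-adj {x = inj₁ _} {inj₂ _} _ = tt
swap-adj {x = inj₂ _} {inj₁ _} _ = tt

KSet-swap : ∀ {n} (T₁ T₂ : Subset n) x → KSet T₁ T₂ (swap x) ≡ KSet T₂ T₁ x
KSet-swap T₁ T₂ (inj₁ _) = refl
KSet-swap T₁ T₂ (inj₂ _) = refl

strongGeodetic-swap : ∀ {n} (T₁ T₂ : Subset n) →
                      StrongGeodetic (KAdj n) (KSet T₁ T₂) → StrongGeodetic (KAdj n) (KSet T₂ T₁)
strongGeodetic-swap T₁ T₂ =
  strongGeodetic-involution swap swap-involutive swap-adj (KSet T₁ T₂) (KSet T₂ T₁)
    (sym ∘ KSet-swap T₁ T₂)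

shortestPath-length≤3 : ∀ {n} {x y : KV n} {p} → IsShortestPath (KAdj n) x y p → length p ≤ 3
shortestPath-length≤3 {x = inj₁ i} {inj₁ j} (_ , p-min) =
  p-min (inj₁ i ∷ inj₂ i ∷ inj₁ j ∷ []) (refl , tt , tt , refl)
shortestPath-length≤3 {x = inj₁ i} {inj₂ j} (_ , p-min) =
  ≤-trans (p-min (inj₁ i ∷ inj₂ j ∷ []) (refl , tt , refl)) (n≤1+n 2)
shortestPath-length≤3 {x = inj₂ i} {inj₁ j} (_ , p-min) =
  ≤-trans (p-min (inj₂ i ∷ inj₁ j ∷ []) (refl , tt , refl)) (n≤1+n 2)
shortestPath-length≤3 {x = inj₂ i} {inj₂ j} (_ , p-min) =
  p-min (inj₂ i ∷ inj₁ i ∷ inj₂ j ∷ []) (refl , tt , tt , refl)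

between-Ys : ∀ {n} {i : Fin n} {x y} → KAdj n x (inj₁ i) → KAdj n (inj₁ i) y →
             ∃₂ λ u v → x ≡ inj₂ u × y ≡ inj₂ v
between-Ys {x = inj₂ u} {inj₂ v} _ _ = u , v , refl , refl

interior-vertex : ∀ {n} {i : Fin n} {x y p} → IsWalk (KAdj n) x y p → length p ≤ 3 → x ≢ y →
                  inj₁ i ∈ p → inj₁ i ≢ x → inj₁ i ≢ y →
                  ∃₂ λ u v → x ≡ inj₂ u × y ≡ inj₂ v × p ≡ x ∷ inj₁ i ∷ y ∷ []
interior-vertex {p = p} p-walk p≤3 x≢y i∈p i≢x i≢y with short-walk p x≢y p-walk p≤3
interior-vertex _ _ _ (here i≡x)                 i≢x _   | inj₁ refl = ⊥-elim (i≢x i≡x)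
interior-vertex _ _ _ (there (here i≡y))         _   i≢y | inj₁ refl = ⊥-elim (i≢y i≡y)
interior-vertex _ _ _ (here i≡x)                 i≢x _   | inj₂ (_ , refl , _ , _) = ⊥-elim (i≢x i≡x)
interior-vertex _ _ _ (there (there (here i≡y))) _   i≢y | inj₂ (_ , refl , _ , _) = ⊥-elim (i≢y i≡y)
interior-vertex _ _ _ (there (here refl))        _   _   | inj₂ (_ , refl , x~i , i~y) =
  let u , v , x≡u , y≡v = between-Ys x~i i~y in u , v , x≡u , y≡v , refl

midpointˣ : ∀ {n} → Fin n → List (KV n) → Fin n
midpointˣ _ (_ ∷ inj₁ k ∷ _) = k
midpointˣ d _                = d

∣∁T₁∣≤∣T₂∣C2 : ∀ {n} (T₁ T₂ : Subset n) → StrongGeodetic (KAdj n) (KSet T₁ T₂) → ∣ ∁ T₁ ∣ ≤ ∣ T₂ ∣ C 2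
∣∁T₁∣≤∣T₂∣C2 {n} T₁ T₂ (g , g-geodesic , g-covers) = begin
  ∣ ∁ T₁ ∣                     ≤⟨ ∣∁p∣≤length T₁ midpoints outside∈midpoints ⟩
  length midpoints             ≡⟨ length-map midpoint (pairs (elements T₂)) ⟩
  length (pairs (elements T₂)) ≡⟨ length-pairs (elements T₂) ⟩
  length (elements T₂) C 2     ≡⟨ cong (_C 2) (length-elements T₂) ⟩
  ∣ T₂ ∣ C 2                   ∎
  where
  open ≤-Reasoning

  midpoint : Fin n × Fin n → Fin n
  midpoint (u , v) = midpointˣ u (g (inj₂ u) (inj₂ v))

  midpoints : List (Fin n)
  midpoints = map midpoint (pairs (elements T₂))

  endpoint-in-T₁ : ∀ {i z} → KSet T₁ T₂ z ≡ true → inj₁ i ≡ z → i ∈ˢ T₁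
  endpoint-in-T₁ z∈T refl = lookup⇒[]= _ T₁ z∈T

  outside∈midpoints : ∀ {i} → i ∉ˢ T₁ → i ∈ midpoints
  outside∈midpoints {i} i∉T₁ with g-covers (inj₁ i)
  ... | x , y , x∈T , y∈T , x≢y , i∈gxy with g-geodesic x y x∈T y∈T x≢y
  ... | gxy-shortest , gyx≡rev
    with interior-vertex (proj₁ gxy-shortest) (shortestPath-length≤3 gxy-shortest) x≢y i∈gxy
           (i∉T₁ ∘ endpoint-in-T₁ x∈T) (i∉T₁ ∘ endpoint-in-T₁ y∈T)
  ... | u , v , refl , refl , gxy≡uiv
    with pairs-complete (elements-complete T₂ x∈T) (elements-complete T₂ y∈T) (x≢y ∘ cong inj₂)
  ... | inj₁ uv∈pairs = subst (_∈ midpoints) (cong (midpointˣ u) gxy≡uiv) (∈-map⁺ midpoint uv∈pairs)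
  ... | inj₂ vu∈pairs = subst (_∈ midpoints) (cong (midpointˣ v) (trans gyx≡rev (cong reverse gxy≡uiv)))
                              (∈-map⁺ midpoint vu∈pairs)

initialSegment : ∀ n → ℕ → Subset n
initialSegment zero    _       = []
initialSegment (suc n) zero    = ⊥
initialSegment (suc n) (suc a) = inside ∷ initialSegment n a

∣initialSegment∣ : ∀ {n a} → a ≤ n → ∣ initialSegment n a ∣ ≡ a
∣initialSegment∣ {zero}  z≤n       = refl
∣initialSegment∣ {suc n} z≤n       = ∣⊥∣≡0 (suc n)
∣initialSegment∣ {suc n} (s≤s a≤n) = cong suc (∣initialSegment∣ a≤n)

lookup-initialSegment : ∀ {n a} (i : Fin n) → toℕ i < a → lookup (initialSegment n a) i ≡ true
lookup-initialSegment {suc n} {suc a} zero    _         = refl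
lookup-initialSegment {suc n} {suc a} (suc i) (s≤s i<a) = lookup-initialSegment i i<a

lookup-initialSegment-fromℕ< : ∀ {n a m} (m<n : m < n) → m < a →
                               lookup (initialSegment n a) (fromℕ< m<n) ≡ true
lookup-initialSegment-fromℕ< m<n m<a =
  lookup-initialSegment (fromℕ< m<n) (subst (_< _) (sym (toℕ-fromℕ< m<n)) m<a)

-- The enumeration {u < w} ↦ C(w,2) + u of the 2-subsets of ℕ; unpair inverts it.
pairCode : ℕ → ℕ → ℕ
pairCode i j = (i ⊔ j) C 2 + i ⊓ j

pairCode-comm : ∀ i j → pairCode i j ≡ pairCode j i
pairCode-comm i j = cong₂ _+_ (cong (_C 2) (⊔-comm i j)) (⊓-comm i j)

pairCode-≤ : ∀ {u w} → u ≤ w → pairCode u w ≡ w C 2 + u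
pairCode-≤ u≤w = cong₂ _+_ (cong (_C 2) (m≤n⇒m⊔n≡n u≤w)) (m≤n⇒m⊓n≡m u≤w)

unpair : ∀ k m → m < k C 2 → ∃₂ λ u w → u < w × w < k × w C 2 + u ≡ m
unpair (suc k) m m<[1+k]C2 with m <? k C 2
... | yes m<kC2 =
  let u , w , u<w , w<k , code≡m = unpair k m m<kC2 in u , w , u<w , m<n⇒m<1+n w<k , code≡m
... | no  m≮kC2 =
  let u , kC2+u≡m = m≤n⇒∃[o]m+o≡n (≮⇒≥ m≮kC2)
      kC2+u<kC2+k = subst₂ _<_ (sym kC2+u≡m) (trans ([1+n]C2≡n+nC2 k) (+-comm k (k C 2))) m<[1+k]C2
  in u , k , +-cancelˡ-< (k C 2) u k kC2+u<kC2+k , ≤-refl , kC2+u≡m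

toℕ-mod : ∀ {n} .{{_ : NonZero n}} (i : Fin n) → toℕ i mod n ≡ i
toℕ-mod i = toℕ-injective (trans (toℕ-fromℕ< _) (m<n⇒m%n≡m (toℕ<n i)))

module _ {n : ℕ} .{{_ : NonZero n}} where

  -- The pair {i, j} of Y-vertices is routed through the X-vertex a + pairCode i j.
  geodesic : ℕ → ℕ → KV n → KV n → List (KV n)
  geodesic a b (inj₁ i) (inj₁ j) = inj₁ i ∷ inj₂ ((b + pairCode (toℕ i) (toℕ j)) mod n) ∷ inj₁ j ∷ []
  geodesic a b (inj₁ i) (inj₂ j) = inj₁ i ∷ inj₂ j ∷ []
  geodesic a b (inj₂ i) (inj₁ j) = inj₂ i ∷ inj₁ j ∷ []
  geodesic a b (inj₂ i) (inj₂ j) = inj₂ i ∷ inj₁ ((a + pairCode (toℕ i) (toℕ j)) mod n) ∷ inj₂ j ∷ []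

  geodesic-swap : ∀ a b x y → geodesic a b (swap x) (swap y) ≡ map swap (geodesic b a x y)
  geodesic-swap a b (inj₁ _) (inj₁ _) = refl
  geodesic-swap a b (inj₁ _) (inj₂ _) = refl
  geodesic-swap a b (inj₂ _) (inj₁ _) = refl
  geodesic-swap a b (inj₂ _) (inj₂ _) = refl

  geodesic-isShortestPath : ∀ a b x y → x ≢ y →
    IsShortestPath (KAdj n) x y (geodesic a b x y) × geodesic a b y x ≡ reverse (geodesic a b x y)
  geodesic-isShortestPath a b (inj₁ i) (inj₁ j) x≢y =
    ((refl , tt , tt , refl) , λ q q-walk → walk-length≥3 q x≢y (λ ()) q-walk) ,
    cong (λ c → inj₁ j ∷ inj₂ ((b + c) mod n) ∷ inj₁ i ∷ []) (pairCode-comm (toℕ j) (toℕ i))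
  geodesic-isShortestPath a b (inj₁ i) (inj₂ j) x≢y = ((refl , tt , refl) , λ q → walk-length≥2 q x≢y) , refl
  geodesic-isShortestPath a b (inj₂ i) (inj₁ j) x≢y = ((refl , tt , refl) , λ q → walk-length≥2 q x≢y) , refl
  geodesic-isShortestPath a b (inj₂ i) (inj₂ j) x≢y =
    ((refl , tt , tt , refl) , λ q q-walk → walk-length≥3 q x≢y (λ ()) q-walk) ,
    cong (λ c → inj₂ j ∷ inj₁ ((a + c) mod n) ∷ inj₂ i ∷ []) (pairCode-comm (toℕ j) (toℕ i))

  pair-with-code : ∀ {b} → b ≤ n → (i : Fin n) → ∀ a m → a + m ≡ toℕ i → m < b C 2 →
    ∃₂ λ u v → lookup (initialSegment n b) u ≡ true × lookup (initialSegment n b) v ≡ true × u ≢ v ×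
               (a + pairCode (toℕ u) (toℕ v)) mod n ≡ i
  pair-with-code {b} b≤n i a m a+m≡i m<bC2 =
    let u , w , u<w , w<b , code≡m = unpair b m m<bC2
        w<n = <-≤-trans w<b b≤n
        u<n = <-trans u<w w<n
        code≡ : pairCode (toℕ (fromℕ< u<n)) (toℕ (fromℕ< w<n)) ≡ m
        code≡ = trans (cong₂ pairCode (toℕ-fromℕ< u<n) (toℕ-fromℕ< w<n)) (trans (pairCode-≤ (<⇒≤ u<w)) code≡m)
    in fromℕ< u<n , fromℕ< w<n ,
       lookup-initialSegment-fromℕ< u<n (<-trans u<w w<b) , lookup-initialSegment-fromℕ< w<n w<b ,
       (λ u≡w → <⇒≢ u<w (trans (sym (toℕ-fromℕ< u<n)) (trans (cong toℕ u≡w) (toℕ-fromℕ< w<n)))) ,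
       trans (cong (λ c → (a + c) mod n) code≡) (trans (cong (_mod n) a+m≡i) (toℕ-mod i))

  initialSegments : ℕ → ℕ → KV n → Bool
  initialSegments a b = KSet (initialSegment n a) (initialSegment n b)

  geodesic-coversˣ : ∀ {a b} → 1 ≤ b → b ≤ n → n ≤ a + b C 2 → ∀ i →
                     Covers (initialSegments a b) (geodesic a b) (inj₁ i)
  geodesic-coversˣ {a} {b} 1≤b b≤n n≤a+bC2 i with toℕ i <? a
  ... | yes i<a = inj₁ i , inj₂ (fromℕ< 0<n) , lookup-initialSegment i i<a ,
                  lookup-initialSegment-fromℕ< 0<n 1≤b , (λ ()) , here refl
    where 0<n = <-≤-trans 1≤b b≤n
  ... | no  i≮a =
    let m , a+m≡i = m≤n⇒∃[o]m+o≡n (≮⇒≥ i≮a)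
        m<bC2 = +-cancelˡ-< a m (b C 2) (<-≤-trans (subst (_< n) (sym a+m≡i) (toℕ<n i)) n≤a+bC2)
        u , v , u∈ , v∈ , u≢v , mid≡i = pair-with-code b≤n i a m a+m≡i m<bC2
    in inj₂ u , inj₂ v , u∈ , v∈ , u≢v ∘ inj₂-injective , there (here (cong inj₁ (sym mid≡i)))

  geodesic-coversʸ : ∀ {a b} → 1 ≤ a → a ≤ n → n ≤ b + a C 2 → ∀ i →
                     Covers (initialSegments a b) (geodesic a b) (inj₂ i)
  geodesic-coversʸ {a} {b} 1≤a a≤n n≤b+aC2 i =
    let x , y , x∈ , y∈ , x≢y , i∈ = geodesic-coversˣ {b} {a} 1≤a a≤n n≤b+aC2 i
    in swap x , swap y ,
       trans (KSet-swap _ _ x) x∈ , trans (KSet-swap _ _ y) y∈ ,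
       x≢y ∘ involutive⇒injective swap swap-involutive ,
       subst (inj₂ i ∈_) (sym (geodesic-swap a b x y)) (∈-map⁺ swap i∈)

  initialSegments-strongGeodetic : ∀ {a b} → 1 ≤ a → 1 ≤ b → a ≤ n → b ≤ n →
    n ≤ a + b C 2 → n ≤ b + a C 2 → StrongGeodetic (KAdj n) (initialSegments a b)
  initialSegments-strongGeodetic {a} {b} 1≤a 1≤b a≤n b≤n n≤a+bC2 n≤b+aC2 =
    geodesic a b ,
    (λ x y _ _ → geodesic-isShortestPath a b x y) ,
    λ { (inj₁ i) → geodesic-coversˣ 1≤b b≤n n≤a+bC2 i
      ; (inj₂ i) → geodesic-coversʸ 1≤a a≤n n≤b+aC2 i }

mC2+n≤[m+n]C2 : ∀ {m} n → 1 ≤ m → m C 2 + n ≤ (m + n) C 2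
mC2+n≤[m+n]C2 {m} zero    _   = ≤-reflexive (trans (+-identityʳ (m C 2)) (cong (_C 2) (sym (+-identityʳ m))))
mC2+n≤[m+n]C2 {m} (suc n) 1≤m = begin
  m C 2 + suc n         ≡⟨ +-suc (m C 2) n ⟩
  suc (m C 2 + n)       ≤⟨ s≤s (mC2+n≤[m+n]C2 n 1≤m) ⟩
  suc ((m + n) C 2)     ≤⟨ +-monoˡ-≤ ((m + n) C 2) (≤-trans 1≤m (m≤m+n m n)) ⟩
  m + n + (m + n) C 2   ≡⟨ [1+n]C2≡n+nC2 (m + n) ⟨
  suc (m + n) C 2       ≡⟨ cong (_C 2) (+-suc m n) ⟨
  (m + suc n) C 2       ∎
  where open ≤-Reasoning

n≤nC2 : ∀ {n} → 3 ≤ n → n ≤ n C 2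
n≤nC2 3≤n with e , refl ← m≤n⇒∃[o]m+o≡n 3≤n = mC2+n≤[m+n]C2 {3} e (s≤s z≤n)

a+bC2≤b+aC2 : ∀ {a b} → 1 ≤ b → b ≤ a → a + b C 2 ≤ b + a C 2
a+bC2≤b+aC2 {b = b} 1≤b b≤a with e , refl ← m≤n⇒∃[o]m+o≡n b≤a = begin
  b + e + b C 2   ≡⟨ +-assoc b e (b C 2) ⟩
  b + (e + b C 2) ≡⟨ cong (b +_) (+-comm e (b C 2)) ⟩
  b + (b C 2 + e) ≤⟨ +-monoʳ-≤ b (mC2+n≤[m+n]C2 e 1≤b) ⟩
  b + (b + e) C 2 ∎
  where open ≤-Reasoning

n≤a+[q+d]C2 : ∀ {n a q d} → 6 ≤ n → a ≤ suc (q + d) → n ≤ a + d + q C 2 → n ≤ a + (q + d) C 2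
n≤a+[q+d]C2 {n} {a} {zero} {d} 6≤n a≤1+d n≤a+d+0 = begin
  n         ≤⟨ n≤a+d ⟩
  a + d     ≤⟨ +-monoʳ-≤ a (n≤nC2 3≤d) ⟩
  a + d C 2 ∎
  where
  open ≤-Reasoning
  n≤a+d : n ≤ a + d
  n≤a+d = ≤-trans n≤a+d+0 (≤-reflexive (+-identityʳ (a + d)))
  3≤d : 3 ≤ d
  3≤d = ≰⇒> λ d≤2 → n≮n 5 (≤-trans 6≤n (≤-trans n≤a+d (+-mono-≤ (≤-trans a≤1+d (s≤s d≤2)) d≤2)))
n≤a+[q+d]C2 {n} {a} {suc q} {d} _ _ n≤a+d+qC2 = begin
  n                   ≤⟨ n≤a+d+qC2 ⟩
  a + d + suc q C 2   ≡⟨ +-assoc a d (suc q C 2) ⟩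
  a + (d + suc q C 2) ≡⟨ cong (a +_) (+-comm d (suc q C 2)) ⟩
  a + (suc q C 2 + d) ≤⟨ +-monoʳ-≤ a (mC2+n≤[m+n]C2 {suc q} d (s≤s z≤n)) ⟩
  a + (suc q + d) C 2 ∎
  where open ≤-Reasoning

⌈n/2⌉≤1+⌊n/2⌋ : ∀ n → ⌈ n /2⌉ ≤ suc ⌊ n /2⌋
⌈n/2⌉≤1+⌊n/2⌋ zero          = z≤n
⌈n/2⌉≤1+⌊n/2⌋ (suc zero)    = ≤-refl
⌈n/2⌉≤1+⌊n/2⌋ (suc (suc n)) = s≤s (⌈n/2⌉≤1+⌊n/2⌋ n)

module Balancing {n p q : ℕ} (6≤n : 6 ≤ n) (2+q≤p : 2 + q ≤ p) (p≤n : p ≤ n) (n≤p+qC2 : n ≤ p + q C 2) where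

  a b : ℕ
  a = ⌈ p + q /2⌉
  b = ⌊ p + q /2⌋

  b+a≡p+q : b + a ≡ p + q
  b+a≡p+q = ⌊n/2⌋+⌈n/2⌉≡n (p + q)

  b≤a : b ≤ a
  b≤a = ⌊n/2⌋≤⌈n/2⌉ (p + q)

  a≤1+b : a ≤ suc b
  a≤1+b = ⌈n/2⌉≤1+⌊n/2⌋ (p + q)

  q<b : q < b
  q<b = ≰⇒> λ b≤q → 1+n≰n (begin
    suc (suc (q + q)) ≤⟨ +-monoˡ-≤ q 2+q≤p ⟩
    p + q             ≡⟨ b+a≡p+q ⟨
    b + a             ≤⟨ +-mono-≤ b≤q (≤-trans a≤1+b (s≤s b≤q)) ⟩
    q + suc q         ≡⟨ +-suc q q ⟩
    suc (q + q)       ∎)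
    where open ≤-Reasoning

  d : ℕ
  d = b ∸ q

  q+d≡b : q + d ≡ b
  q+d≡b = m+[n∸m]≡n (<⇒≤ q<b)

  a+d≡p : a + d ≡ p
  a+d≡p = +-cancelʳ-≡ q (a + d) p (begin
    a + d + q   ≡⟨ +-assoc a d q ⟩
    a + (d + q) ≡⟨ cong (a +_) (+-comm d q) ⟩
    a + (q + d) ≡⟨ cong (a +_) q+d≡b ⟩
    a + b       ≡⟨ +-comm a b ⟩
    b + a       ≡⟨ b+a≡p+q ⟩
    p + q       ∎)
    where open ≡-Reasoning

  1≤b : 1 ≤ b
  1≤b = ≤-trans (s≤s z≤n) q<b

  1≤a : 1 ≤ a
  1≤a = ≤-trans 1≤b b≤a

  a≤n : a ≤ n
  a≤n = ≤-trans (≤-trans (m≤m+n a d) (≤-reflexive a+d≡p)) p≤n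

  b≤n : b ≤ n
  b≤n = ≤-trans b≤a a≤n

  n≤a+bC2 : n ≤ a + b C 2
  n≤a+bC2 = subst (λ x → n ≤ a + x C 2) q+d≡b
    (n≤a+[q+d]C2 6≤n (subst (λ x → a ≤ suc x) (sym q+d≡b) a≤1+b)
                     (subst (λ x → n ≤ x + q C 2) (sym a+d≡p) n≤p+qC2))

  n≤b+aC2 : n ≤ b + a C 2
  n≤b+aC2 = ≤-trans n≤a+bC2 (a+bC2≤b+aC2 1≤b b≤a)

  ∣a-b∣≤1 : ∣ a - b ∣ ≤ 1
  ∣a-b∣≤1 = subst (_≤ 1) (sym (m≤n⇒∣n-m∣≡n∸m b≤a))
    (m≤n+o⇒m∸n≤o a b (subst (a ≤_) (+-comm 1 b) a≤1+b))

balanced : ∀ {n} → 6 ≤ n → (T₁ T₂ : Subset n) → StrongGeodetic (KAdj n) (KSet T₁ T₂) → 2 + ∣ T₂ ∣ ≤ ∣ T₁ ∣ →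
  ∃[ T₁′ ] ∃[ T₂′ ] ( StrongGeodetic (KAdj n) (KSet T₁′ T₂′)
    × ∣ T₁′ ∣ + ∣ T₂′ ∣ ≡ ∣ T₁ ∣ + ∣ T₂ ∣
    × ∣ ∣ T₁′ ∣ - ∣ T₂′ ∣ ∣ ≤ 1 )
balanced {n} 6≤n T₁ T₂ T-sg 2+t₂≤t₁ =
  initialSegment n a , initialSegment n b ,
  initialSegments-strongGeodetic 1≤a 1≤b a≤n b≤n n≤a+bC2 n≤b+aC2 ,
  trans (cong₂ _+_ (∣initialSegment∣ a≤n) (∣initialSegment∣ b≤n)) (trans (+-comm a b) b+a≡p+q) ,
  subst₂ (λ a′ b′ → ∣ a′ - b′ ∣ ≤ 1) (sym (∣initialSegment∣ a≤n)) (sym (∣initialSegment∣ b≤n)) ∣a-b∣≤1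
  where
  instance
    n-nonZero : NonZero n
    n-nonZero = >-nonZero (≤-trans (s≤s z≤n) 6≤n)

  n≤t₁+t₂C2 : n ≤ ∣ T₁ ∣ + ∣ T₂ ∣ C 2
  n≤t₁+t₂C2 = ≤-trans (m≤n+m∸n n ∣ T₁ ∣)
    (+-monoʳ-≤ ∣ T₁ ∣ (subst (_≤ ∣ T₂ ∣ C 2) (∣∁p∣≡n∸∣p∣ T₁) (∣∁T₁∣≤∣T₂∣C2 T₁ T₂ T-sg)))

  open Balancing 6≤n 2+t₂≤t₁ (∣p∣≤n T₁) n≤t₁+t₂C2

k≤∣m-n∣⇒k+n≤m : ∀ {k m n} → n ≤ m → k ≤ ∣ m - n ∣ → k + n ≤ m
k≤∣m-n∣⇒k+n≤m {k} {m} {n} n≤m k≤∣m-n∣ = begin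
  k + n     ≤⟨ +-monoˡ-≤ n (subst (k ≤_) (m≤n⇒∣n-m∣≡n∸m n≤m) k≤∣m-n∣) ⟩
  m ∸ n + n ≡⟨ m∸n+n≡m n≤m ⟩
  m         ∎
  where open ≤-Reasoning

lemma2p2 : (n : ℕ) → 6 ≤ n → (T₁ T₂ : Subset n) →
    StrongGeodetic (KAdj n) (KSet T₁ T₂) →
    2 ≤ ∣ ∣ T₁ ∣ - ∣ T₂ ∣ ∣ →
    ∃[ T₁′ ] ∃[ T₂′ ] ( StrongGeodetic (KAdj n) (KSet T₁′ T₂′)
      × ∣ T₁′ ∣ + ∣ T₂′ ∣ ≡ ∣ T₁ ∣ + ∣ T₂ ∣
      × ∣ ∣ T₁′ ∣ - ∣ T₂′ ∣ ∣ < ∣ ∣ T₁ ∣ - ∣ T₂ ∣ ∣ )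
lemma2p2 n 6≤n T₁ T₂ T-sg 2≤∣t₁-t₂∣ with ≤-total ∣ T₂ ∣ ∣ T₁ ∣
... | inj₁ t₂≤t₁ =
  let T₁′ , T₂′ , T′-sg , t′-sum , ∣t₁′-t₂′∣≤1 =
        balanced 6≤n T₁ T₂ T-sg (k≤∣m-n∣⇒k+n≤m t₂≤t₁ 2≤∣t₁-t₂∣)
  in T₁′ , T₂′ , T′-sg , t′-sum , <-≤-trans (s≤s ∣t₁′-t₂′∣≤1) 2≤∣t₁-t₂∣
... | inj₂ t₁≤t₂ =
  let T₂′ , T₁′ , T′-sg , t′-sum , ∣t₂′-t₁′∣≤1 =
        balanced 6≤n T₂ T₁ (strongGeodetic-swap T₁ T₂ T-sg)
          (k≤∣m-n∣⇒k+n≤m t₁≤t₂ (subst (2 ≤_) (∣-∣-comm ∣ T₁ ∣ ∣ T₂ ∣) 2≤∣t₁-t₂∣))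
  in T₁′ , T₂′ , strongGeodetic-swap T₂′ T₁′ T′-sg ,
     trans (+-comm ∣ T₁′ ∣ ∣ T₂′ ∣) (trans t′-sum (+-comm ∣ T₂ ∣ ∣ T₁ ∣)) ,
     <-≤-trans (s≤s (subst (_≤ 1) (∣-∣-comm ∣ T₂′ ∣ ∣ T₁′ ∣) ∣t₂′-t₁′∣≤1)) 2≤∣t₁-t₂∣
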